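{- (Deduction theorem for $\mathbf{vD}$.) For all $\Gamma\cup\{\alpha,\beta\}\subseteq\mathcal{L}$: $\Gamma\cup\{\alpha\}\vdash_{\mathbf{vD}}\beta$ if and only if $\Gamma\vdash_{\mathbf{vD}}\alpha\longrightarrow\beta$.
   Context: Let $V$ be a denumerable set of propositional variables and $\mathcal{L}$ the set of formulas generated from $V$ by the binary connectives $\land,\lor,\longrightarrow$ and the unary connectives $\neg,\circ$. Fix a formula $\beta_0$ and set $\bot:=\beta_0\land(\neg\beta_0\land\circ\beta_0)$; for every formula $\alpha$ let $\sim\alpha$ abbreviate $\alpha\longrightarrow\bot$. The logic $\mathbf{vD}=\langle\mathcal{L},\vdash_{\mathbf{vD}}\rangle$ has the following axiom schemas (for all $\alpha,\beta,\gamma\in\mathcal{L}$): (1) $\alpha\to(\beta\to\alpha)$; (2) $(\alpha\to(\beta\to\gamma))\to((\alpha\to\beta)\to(\alpha\to\gamma))$; (3) $\alpha\to(\beta\to(\alpha\land\beta))$; (4) $(\alpha\land\beta)\to\alpha$; (5) $(\alpha\land\beta)\to\beta$; (6) $\alpha\to(\alpha\lor\beta)$; (7) $\beta\to(\alpha\lor\beta)$; (8) $(\alpha\to\beta)\lor\alpha$; (9) $\alpha\lor\neg\alpha$; (10) $(\alpha\to\gamma)\to((\neg\alpha\to\gamma)\to((\alpha\lor\neg\alpha)\to\gamma))$; (11) $((\alpha\to\beta)\to\gamma)\to((\alpha\to\gamma)\to(((\alpha\to\beta)\lor\alpha)\to\gamma))$; (12) $\circ\alpha\to(\alpha\to(\neg\alpha\to\beta))$;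 (13) $\circ\alpha\lor(\alpha\land\neg\alpha)$; (14) $(\circ\alpha\to\gamma)\to(((\alpha\land\neg\alpha)\to\gamma)\to((\circ\alpha\lor(\alpha\land\neg\alpha))\to\gamma))$; (15) $\sim\neg\alpha\to\sim\neg\sim\neg\alpha$; (16) $\sim\neg\sim\neg\alpha\to\sim\neg\alpha$; (17) $\sim\neg(\alpha\land\beta)\to(\sim\neg\alpha\land\sim\neg\beta)$; (18) $(\sim\neg\alpha\land\sim\neg\beta)\to\sim\neg(\alpha\land\beta)$ (here $\to$ denotes $\longrightarrow$). Rules: (MP) from $\alpha$ and $\alpha\longrightarrow\beta$ infer $\beta$; (N) from $\alpha$ infer $\neg\alpha\longrightarrow\sim\alpha$, applicable only when $\alpha$ is a theorem. A derivation of $\varphi$ from $\Gamma$ is a finite sequence $\varphi_1,\dots,\varphi_n=\varphi$ where each $\varphi_i$ is an axiom instance, or belongs to $\Gamma$, or follows by MP from earlier members, or is obtained by (N) from an earlier $\varphi_j$ which is a theorem. $\Gamma\vdash_{\mathbf{vD}}\varphi$ means such a derivation exists; $\varphi$ is a theorem if $\emptyset\vdash_{\mathbf{vD}}\varphi$. -}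

module Defs where

open import Data.Nat using (ℕ)
open import Data.Empty using (⊥)
open import Data.Sum using (_⊎_)
open import Relation.Binary.PropositionalEquality using (_≡_)

data Formula : Set where
  var  : ℕ → Formula
  _∧_  : Formula → Formula → Formula
  _∨_  : Formula → Formula → Formula
  _⟶_  : Formula → Formula → Formula
  ¬'_  : Formula → Formula
  ∘_   : Formula → Formula

infixr 5 _⟶_
infixr 6 _∨_
infixr 7 _∧_
infix 8 ¬'_ ∘_

FSet : Set₁
FSet = Formula → Set

∅ : FSet
∅ _ = ⊥

_,,_ : FSet → Formula → FSet
(Γ ,, α) φ = Γ φ ⊎ φ ≡ α

module vD (β₀ : Formula) where

  ⊥' : Formula
  ⊥' = β₀ ∧ (¬' β₀ ∧ ∘ β₀)

  ∼_ : Formula → Formula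
  ∼ α = α ⟶ ⊥'
  infix 8 ∼_

  data Axiom : Formula → Set where
    ax1  : ∀ α β → Axiom (α ⟶ (β ⟶ α))
    ax2  : ∀ α β γ → Axiom ((α ⟶ (β ⟶ γ)) ⟶ ((α ⟶ β) ⟶ (α ⟶ γ)))
    ax3  : ∀ α β → Axiom (α ⟶ (β ⟶ (α ∧ β)))
    ax4  : ∀ α β → Axiom ((α ∧ β) ⟶ α)
    ax5  : ∀ α β → Axiom ((α ∧ β) ⟶ β)
    ax6  : ∀ α β → Axiom (α ⟶ (α ∨ β))
    ax7  : ∀ α β → Axiom (β ⟶ (α ∨ β))
    ax8  : ∀ α β → Axiom ((α ⟶ β) ∨ α)
    ax9  : ∀ α → Axiom (α ∨ ¬' α)
    ax10 : ∀ α γ → Axiom ((α ⟶ γ) ⟶ ((¬' α ⟶ γ) ⟶ ((α ∨ ¬' α) ⟶ γ)))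
    ax11 : ∀ α β γ → Axiom (((α ⟶ β) ⟶ γ) ⟶ ((α ⟶ γ) ⟶ (((α ⟶ β) ∨ α) ⟶ γ)))
    ax12 : ∀ α β → Axiom (∘ α ⟶ (α ⟶ (¬' α ⟶ β)))
    ax13 : ∀ α → Axiom (∘ α ∨ (α ∧ ¬' α))
    ax14 : ∀ α γ → Axiom ((∘ α ⟶ γ) ⟶ (((α ∧ ¬' α) ⟶ γ) ⟶ ((∘ α ∨ (α ∧ ¬' α)) ⟶ γ)))
    ax15 : ∀ α → Axiom (∼ ¬' α ⟶ ∼ ¬' ∼ ¬' α)
    ax16 : ∀ α → Axiom (∼ ¬' ∼ ¬' α ⟶ ∼ ¬' α)
    ax17 : ∀ α β → Axiom (∼ ¬' (α ∧ β) ⟶ (∼ ¬' α ∧ ∼ ¬' β))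
    ax18 : ∀ α β → Axiom ((∼ ¬' α ∧ ∼ ¬' β) ⟶ ∼ ¬' (α ∧ β))

  data _⊢_ (Γ : FSet) : Formula → Set where
    axiom : ∀ {φ} → Axiom φ → Γ ⊢ φ
    hyp   : ∀ {φ} → Γ φ → Γ ⊢ φ
    mp    : ∀ {α β} → Γ ⊢ α → Γ ⊢ (α ⟶ β) → Γ ⊢ β
    nec   : ∀ {α} → ∅ ⊢ α → Γ ⊢ (¬' α ⟶ ∼ α)

  infix 3 _⊢_

{-# OPTIONS --safe #-}
module Submission where

open import Defs
open import Data.Product using (_×_; _,_)
open import Data.Sum using (inj₁; inj₂)
open import Relation.Binary.PropositionalEquality using (refl)
open import Relation.Unary using (_⊆_)

-- The usual Hilbert-style argument by induction on derivations, using axioms (1) and (2).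
-- Rule (N) is no obstacle: it only applies to theorems, so its conclusion is
-- derivable from any set of hypotheses and is treated like an axiom.

module _ (β₀ : Formula) where
  open vD β₀

  ⊢-const : ∀ {Γ α φ} → Γ ⊢ φ → Γ ⊢ α ⟶ φ
  ⊢-const {α = α} {φ} d = mp d (axiom (ax1 φ α))

  ⊢-id : ∀ {Γ} α → Γ ⊢ α ⟶ α
  ⊢-id α = mp (axiom (ax1 α α)) (mp (axiom (ax1 α (α ⟶ α))) (axiom (ax2 α (α ⟶ α) α)))

  ⊢-mono : ∀ {Γ Δ φ} → Γ ⊆ Δ → Γ ⊢ φ → Δ ⊢ φ
  ⊢-mono Γ⊆Δ (axiom ax) = axiom ax
  ⊢-mono Γ⊆Δ (hyp φ∈Γ)  = hyp (Γ⊆Δ φ∈Γ)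
  ⊢-mono Γ⊆Δ (mp d e)   = mp (⊢-mono Γ⊆Δ d) (⊢-mono Γ⊆Δ e)
  ⊢-mono Γ⊆Δ (nec d)    = nec d

  deduction : ∀ {Γ α φ} → Γ ,, α ⊢ φ → Γ ⊢ α ⟶ φ
  deduction                   (axiom ax)        = ⊢-const (axiom ax)
  deduction                   (hyp (inj₁ φ∈Γ))  = ⊢-const (hyp φ∈Γ)
  deduction {α = α}           (hyp (inj₂ refl)) = ⊢-id α
  deduction {α = α} (mp {φ} {ψ} d e)            =
    mp (deduction d) (mp (deduction e) (axiom (ax2 α φ ψ)))
  deduction                   (nec d)           = ⊢-const (nec d)

  deduction⁻¹ : ∀ {Γ α φ} → Γ ⊢ α ⟶ φ → Γ ,, α ⊢ φ
  deduction⁻¹ d = mp (hyp (inj₂ refl)) (⊢-mono inj₁ d)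

theorem2p7 : (β₀ : Formula) (Γ : FSet) (α β : Formula) →
    let open vD β₀ in
    ((Γ ,, α) ⊢ β → Γ ⊢ (α ⟶ β)) × (Γ ⊢ (α ⟶ β) → (Γ ,, α) ⊢ β)
theorem2p7 β₀ Γ α β = deduction β₀ , deduction⁻¹ β₀
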